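{- Let $n\geq3$ and let $$\Lambda(Y)=Y^n+\lambda_{n-1}Y^{n-1}+\lambda_{n-2}Y^{n-2}+\cdots+\lambda_1Y+\lambda_0\in\mathbb{F}_q[X][Y]$$ with $\lambda_0\neq0$. Suppose $$\max_{i\neq n-2}\deg\lambda_i=\deg\lambda_{n-2}\geq 2\deg\lambda_{n-1}.$$ If $\deg\lambda_{n-2}$ is odd, then $\Lambda$ has no root in $\mathbb{F}_q((X^{ -1}))$ of absolute value $>1$.
   Context: $\mathbb{F}_q$ is a finite field, $\mathbb{F}_q((X^{ -1}))$ the field of formal Laurent series $\sum_{i\geq n_0}\omega_iX^{ -i}$ over $\mathbb{F}_q$, with absolute value $|\omega|=q^{\deg\omega}$ where $\deg\omega$ is the largest exponent of $X$ with nonzero coefficient ($|0|=0$), extended uniquely to an algebraic closure. For $\lambda\in\mathbb{F}_q[X]$, $\deg\lambda$ is its usual degree ($\deg0=-\infty$); the index $i$ in the maximum ranges over the indices of the coefficients of $\Lambda$ (with the leading coefficient $1$ of degree $0$). -}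

module Defs where

open import Level using (Level; _⊔_) renaming (suc to lsuc)
open import Algebra.Bundles using (CommutativeRing)
open import Data.Nat as ℕ using (ℕ; zero; suc; _∸_; _<ᵇ_)
open import Data.Integer as ℤ using (ℤ; +_)
open import Data.Fin using (Fin)
open import Data.Bool using (if_then_else_)
open import Data.List using (List; []; _∷_; length; reverse; foldr; map; upTo)
open import Data.Maybe using (Maybe; just; nothing)
open import Data.Product using (Σ; ∃; _×_)
open import Data.Unit.Polymorphic using (⊤)
open import Relation.Nullary using (¬_; yes; no)
open import Relation.Binary using (Decidable)

record FiniteField (c ℓ : Level) : Set (lsuc (c ⊔ ℓ)) where
  field
    commRing : CommutativeRing c ℓ
  open CommutativeRing commRing public
  field
    _≟_      : Decidable _≈_
    1≉0      : ¬ (1# ≈ 0#)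
    inverse  : ∀ x → ¬ (x ≈ 0#) → Σ Carrier (λ y → (x * y) ≈ 1#)
    size     : ℕ
    enum     : Fin size → Carrier
    enum-onto : ∀ x → Σ (Fin size) (λ i → enum i ≈ x)

module _ {c ℓ : Level} (F : FiniteField c ℓ) where
  open FiniteField F

  -- Polynomials in F_q[X]: coefficient lists, lowest degree first.
  Poly : Set c
  Poly = List Carrier

  -- Degree (nothing = -∞): largest index of a nonzero coefficient.
  deg : Poly → Maybe ℕ
  deg [] = nothing
  deg (a ∷ as) with deg as
  ... | just d = just (suc d)
  ... | nothing with a ≟ 0#
  ...   | yes _ = nothing
  ...   | no _  = just 0

  -- Formal Laurent series in X^{-1}:  Σ_{i ≥ 0} coeff i · X^(top - i).
  record Laurent : Set c where
    constructor laurent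
    field
      top   : ℤ
      coeff : ℕ → Carrier
  open Laurent public

  zeroL : Laurent
  zeroL = laurent (+ 0) (λ _ → 0#)

  oneL : Laurent
  oneL = laurent (+ 0) (λ { zero → 1# ; (suc _) → 0# })

  -- coefficients of a re-expressed with a larger top d (d ≥ top a)
  shiftTo : ℤ → Laurent → ℕ → Carrier
  shiftTo d a i with ℤ.∣ d ℤ.- top a ∣
  ... | s = if i <ᵇ s then 0# else coeff a (i ∸ s)

  addL : Laurent → Laurent → Laurent
  addL a b = laurent d (λ i → shiftTo d a i + shiftTo d b i)
    where d = top a ℤ.⊔ top b

  mulL : Laurent → Laurent → Laurent
  mulL a b = laurent (top a ℤ.+ top b)
    (λ i → foldr _+_ 0# (map (λ j → coeff a j * coeff b (i ∸ j)) (upTo (suc i))))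

  powL : Laurent → ℕ → Laurent
  powL a zero    = oneL
  powL a (suc k) = mulL a (powL a k)

  nthOr0 : List Carrier → ℕ → Carrier
  nthOr0 []       _       = 0#
  nthOr0 (x ∷ xs) zero    = x
  nthOr0 (x ∷ xs) (suc i) = nthOr0 xs i

  polyL : Poly → Laurent
  polyL p = laurent (+ (length p ∸ 1)) (nthOr0 (reverse p))

  lowerSum : (ℕ → Poly) → Laurent → ℕ → Laurent
  lowerSum λs ω zero    = zeroL
  lowerSum λs ω (suc i) = addL (lowerSum λs ω i) (mulL (polyL (λs i)) (powL ω i))

  evalΛ : ℕ → (ℕ → Poly) → Laurent → Laurent
  evalΛ n λs ω = addL (powL ω n) (lowerSum λs ω n)

  IsZeroL : Laurent → Set ℓ
  IsZeroL a = ∀ i → coeff a i ≈ 0#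

  -- |ω| > 1, i.e. deg ω ≥ 1: some nonzero coefficient at a positive power of X
  AbsGt1 : Laurent → Set ℓ
  AbsGt1 a = ∃ λ i → ¬ (coeff a i ≈ 0#) × (+ i ℤ.< top a)

_≤ᵈ_ : Maybe ℕ → ℕ → Set
nothing ≤ᵈ D = ⊤
just a  ≤ᵈ D = a ℕ.≤ D

twice : Maybe ℕ → Maybe ℕ
twice nothing  = nothing
twice (just a) = just (2 ℕ.* a)

-- Write d ≥ 1 for deg ω and D = 2k + 1 for deg λ_{n-2}.  The summands of
-- Λ(ω) have degrees n d (for ω^n), at most D + i d (for i ≤ n - 2, with
-- equality at i = n - 2) and at most k + (n - 1) d (for i = n - 1, since
-- 2 deg λ_{n-1} ≤ D).  Because D is odd, either D < 2d, and then ω^n is the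
-- only summand reaching degree n d, or 2d < D, and then λ_{n-2} ω^{n-2} is
-- the only one reaching degree D + (n - 2) d.  In both cases the coefficient
-- of that power of X in Λ(ω) is a product of leading coefficients, hence
-- nonzero.
module Submission where

open import Defs
open import Level using (Level)
open import Data.Nat using (ℕ; suc; _*_; _≤_; _<_; _∸_)
open import Data.Maybe using (just; nothing)
open import Data.Product using (Σ; ∃; _×_)
open import Relation.Nullary using (¬_)
open import Relation.Binary.PropositionalEquality using (_≡_; _≢_)

open import Data.Bool using (true; false; T; if_then_else_)
open import Data.Empty using (⊥-elim)
open import Data.Integer as ℤ using (ℤ; +_; -[1+_]; +<+; +≤+; -<+)
import Data.Integer.Properties as ℤP
open import Data.Integer.Tactic.RingSolver using (solve-∀)
open import Data.List using ([]; _∷_; length; reverse; foldr; map; applyUpTo; _++_)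
import Data.List.Properties as ListP
open import Data.Nat as ℕ using (zero; z≤n; s≤s; _<ᵇ_)
import Data.Nat.Properties as ℕP
open import Data.Product using (_,_; proj₁; proj₂)
open import Data.Sum using (inj₁; inj₂)
open import Function using (_∘_)
open import Relation.Binary using (tri<; tri≈; tri>)
import Relation.Binary.PropositionalEquality as P
open import Relation.Nullary using (yes; no)

j≡i+[j-i] : ∀ i j → j ≡ i ℤ.+ (j ℤ.- i)
j≡i+[j-i] = solve-∀

j-i≡+⇒i≤j : ∀ {i j k} → j ℤ.- i ≡ + k → i ℤ.≤ j
j-i≡+⇒i≤j eq = ℤP.0≤i-j⇒j≤i (P.subst (+ 0 ℤ.≤_) (P.sym eq) (+≤+ z≤n))

j-i≡+suc⇒i<j : ∀ {i j k} → j ℤ.- i ≡ + suc k → i ℤ.< j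
j-i≡+suc⇒i<j {i} {j} {k} eq =
  P.subst (ℤ._< j) (ℤP.+-identityʳ i)
    (P.subst (i ℤ.+ + 0 ℤ.<_) (P.sym (P.trans (j≡i+[j-i] i j) (P.cong (ℤ._+_ i) eq)))
      (ℤP.+-monoʳ-< i (+<+ (s≤s z≤n))))

j-i≡-[1+]⇒j<i : ∀ {i j k} → j ℤ.- i ≡ -[1+ k ] → j ℤ.< i
j-i≡-[1+]⇒j<i {i} {j} {k} eq =
  P.subst (ℤ._< i) (P.sym (P.trans (j≡i+[j-i] i j) (P.cong (ℤ._+_ i) eq)))
    (P.subst (i ℤ.+ -[1+ k ] ℤ.<_) (ℤP.+-identityʳ i) (ℤP.+-monoʳ-< i -<+))

i<j⇒j-i≡+suc : ∀ {i j} → i ℤ.< j → ∃ λ k → j ℤ.- i ≡ + suc k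
i<j⇒j-i≡+suc {i} {j} i<j with j ℤ.- i in eq
... | + suc k  = k , P.refl
... | -[1+ _ ] = ⊥-elim (ℤP.<-asym (j-i≡-[1+]⇒j<i eq) i<j)
... | + zero   = ⊥-elim (ℤP.<⇒≢ i<j (P.sym (P.trans (j≡i+[j-i] i j)
                   (P.trans (P.cong (ℤ._+_ i) eq) (ℤP.+-identityʳ i)))))

t-[t-j]≡j : ∀ t j → t ℤ.- (t ℤ.- j) ≡ j
t-[t-j]≡j = solve-∀

t-m≡[d-m]-[d-t] : ∀ d t m → t ℤ.- m ≡ (d ℤ.- m) ℤ.- (d ℤ.- t)
t-m≡[d-m]-[d-t] = solve-∀

same-difference-< : ∀ {i j i′ j′} → j ℤ.- i ≡ j′ ℤ.- i′ → i′ ℤ.< j′ → i ℤ.< j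
same-difference-< eq i′<j′ = j-i≡+suc⇒i<j (P.trans eq (proj₂ (i<j⇒j-i≡+suc i′<j′)))

+m-+n≡+[m∸n] : ∀ m n → n ℕ.≤ m → + m ℤ.- + n ≡ + (m ∸ n)
+m-+n≡+[m∸n] m n n≤m = P.trans (ℤP.m-n≡m⊖n m n) (ℤP.⊖-≥ n≤m)

+m-+n≡-[1+] : ∀ m n → m < n → ∃ λ r → + m ℤ.- + n ≡ -[1+ r ]
+m-+n≡-[1+] m n m<n with n ∸ m in eq | ℤP.⊖-< m<n
... | suc r | m⊖n≡ = r , P.trans (ℤP.m-n≡m⊖n m n) m⊖n≡
... | zero  | _    = ⊥-elim (ℕP.<⇒≢ (ℕP.m<n⇒0<n∸m m<n) (P.sym eq))

m<n⇒1+2m<n+n : ∀ {m n} → m < n → suc (2 * m) < n ℕ.+ n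
m<n⇒1+2m<n+n {m} {n} m<n rewrite ℕP.+-identityʳ m =
  P.subst (ℕ._≤ n ℕ.+ n) (P.cong suc (ℕP.+-suc m m)) (ℕP.+-mono-≤ m<n m<n)

m≤k⇒n≤k⇒m+n<1+2k : ∀ {m n k} → m ≤ k → n ≤ k → m ℕ.+ n < suc (2 * k)
m≤k⇒n≤k⇒m+n<1+2k {k = k} m≤k n≤k rewrite ℕP.+-identityʳ k = s≤s (ℕP.+-mono-≤ m≤k n≤k)

2m≤1+2k⇒m≤k : ∀ {m k} → 2 * m ≤ suc (2 * k) → m ≤ k
2m≤1+2k⇒m≤k {m} {k} 2m≤1+2k with m ℕ.≤? k
... | yes m≤k = m≤k
... | no  m≰k = ⊥-elim (ℕP.<⇒≱ (P.subst (suc (2 * k) <_) (P.cong (m ℕ.+_) (P.sym (ℕP.+-identityʳ m)))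
                                 (m<n⇒1+2m<n+n (ℕP.≰⇒> m≰k))) 2m≤1+2k)

twice≤ᵈ1+2k⇒≤ᵈk : ∀ {m k} → twice m ≤ᵈ suc (2 * k) → m ≤ᵈ k
twice≤ᵈ1+2k⇒≤ᵈk {nothing} _         = _
twice≤ᵈ1+2k⇒≤ᵈk {just a}  2a≤1+2k = 2m≤1+2k⇒m≤k 2a≤1+2k

module _ {c ℓ : Level} (F : FiniteField c ℓ) where
  open FiniteField F renaming (_*_ to _·_)
  open import Relation.Binary.Reasoning.Setoid setoid

  x≉0∧y≉0⇒x*y≉0 : ∀ {x y} → ¬ x ≈ 0# → ¬ y ≈ 0# → ¬ (x · y) ≈ 0#
  x≉0∧y≉0⇒x*y≉0 {x} {y} x≉0 y≉0 xy≈0 with inverse x x≉0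
  ... | x⁻¹ , xx⁻¹≈1 = y≉0 (begin
    y                ≈⟨ sym (*-identityˡ y) ⟩
    1# · y           ≈⟨ *-cong (trans (sym xx⁻¹≈1) (*-comm x x⁻¹)) refl ⟩
    (x⁻¹ · x) · y    ≈⟨ *-assoc x⁻¹ x y ⟩
    x⁻¹ · (x · y)    ≈⟨ *-cong refl xy≈0 ⟩
    x⁻¹ · 0#         ≈⟨ zeroʳ x⁻¹ ⟩
    0#               ∎)

  -- Coefficients of X^m and degrees of Laurent series

  -- coeff a indexes downwards from X^(top a); coeffAt a m is the
  -- coefficient of X^m itself.
  coeffBelowTop : Laurent F → ℤ → Carrier
  coeffBelowTop a (+ j)    = coeff a j
  coeffBelowTop a -[1+ _ ] = 0#

  coeffAt : Laurent F → ℤ → Carrier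
  coeffAt a m = coeffBelowTop a (top a ℤ.- m)

  DegLe : Laurent F → ℤ → Set ℓ
  DegLe a e = ∀ m → e ℤ.< m → coeffAt a m ≈ 0#

  ExactDeg : Laurent F → ℤ → Set ℓ
  ExactDeg a e = DegLe a e × ¬ coeffAt a e ≈ 0#

  coeffAt-index : ∀ a {m j} → top a ℤ.- m ≡ + j → coeffAt a m ≈ coeff a j
  coeffAt-index a eq = reflexive (P.cong (coeffBelowTop a) eq)

  coeffAt-above : ∀ a {m} → top a ℤ.< m → coeffAt a m ≈ 0#
  coeffAt-above a {m} top<m with top a ℤ.- m in eq
  ... | -[1+ _ ] = refl
  ... | + _      = ⊥-elim (ℤP.<⇒≱ top<m (j-i≡+⇒i≤j eq))

  IsZeroL⇒coeffAt≈0 : ∀ a → IsZeroL F a → ∀ m → coeffAt a m ≈ 0#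
  IsZeroL⇒coeffAt≈0 a a≈0 m with top a ℤ.- m
  ... | + j      = a≈0 j
  ... | -[1+ _ ] = refl

  coeffAt≉0⇒index : ∀ a {m} → ¬ coeffAt a m ≈ 0# → ∃ λ j → top a ℤ.- m ≡ + j
  coeffAt≉0⇒index a {m} a≉0 with top a ℤ.- m
  ... | + j      = j , P.refl
  ... | -[1+ _ ] = ⊥-elim (a≉0 refl)

  DegLe⇒coeff≈0 : ∀ a {e} j → DegLe a e → + j ℤ.< top a ℤ.- e → coeff a j ≈ 0#
  DegLe⇒coeff≈0 a {e} j a≤e j<top-e = begin
    coeff a j                  ≈⟨ coeffAt-index a (t-[t-j]≡j (top a) (+ j)) ⟨
    coeffAt a (top a ℤ.- + j)  ≈⟨ a≤e _ (same-difference-< (swap (top a) e (+ j)) j<top-e) ⟩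
    0#                         ∎
    where
    swap : ∀ t e j → (t ℤ.- j) ℤ.- e ≡ (t ℤ.- e) ℤ.- j
    swap = solve-∀

  oneL-ExactDeg : ExactDeg (oneL F) (+ 0)
  oneL-ExactDeg = (λ _ → coeffAt-above (oneL F)) , 1≉0

  coeffAt≈shifted : ∀ a {m} i s → top a ℤ.- m ≡ + i ℤ.- + s →
    coeffAt a m ≈ (if i <ᵇ s then 0# else coeff a (i ∸ s))
  coeffAt≈shifted a i s eq with i <ᵇ s in i<ᵇs
  ... | true  = coeffAt-above a (j-i≡-[1+]⇒j<i (P.trans eq
                  (proj₂ (+m-+n≡-[1+] i s (ℕP.<ᵇ⇒< i s (P.subst T (P.sym i<ᵇs) _))))))
  ... | false = coeffAt-index a (P.trans eq
                  (+m-+n≡+[m∸n] i s (ℕP.≮⇒≥ (λ i<s → P.subst T i<ᵇs (ℕP.<⇒<ᵇ i<s)))))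

  shiftTo-coeffAt : ∀ d a {m i} → top a ℤ.≤ d → d ℤ.- m ≡ + i → shiftTo F d a i ≈ coeffAt a m
  shiftTo-coeffAt d a {m} {i} top≤d d-m≡i with d ℤ.- top a in eq | ℤP.i≤j⇒0≤j-i top≤d
  ... | + s | _ = sym (coeffAt≈shifted a i s
                    (P.trans (t-m≡[d-m]-[d-t] d (top a) m) (P.cong₂ ℤ._-_ d-m≡i eq)))

  coeffAt-addL : ∀ a b m → coeffAt (addL F a b) m ≈ coeffAt a m + coeffAt b m
  coeffAt-addL a b m with (top a ℤ.⊔ top b) ℤ.- m in eq
  ... | + i      = +-cong (shiftTo-coeffAt _ a (ℤP.i≤i⊔j (top a) (top b)) eq)
                          (shiftTo-coeffAt _ b (ℤP.i≤j⊔i (top a) (top b)) eq)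
  ... | -[1+ _ ] = sym (trans (+-cong (coeffAt-above a (ℤP.≤-<-trans (ℤP.i≤i⊔j (top a) (top b)) top<m))
                                      (coeffAt-above b (ℤP.≤-<-trans (ℤP.i≤j⊔i (top a) (top b)) top<m)))
                              (+-identityʳ 0#))
    where top<m = j-i≡-[1+]⇒j<i eq

  -- Multiplication

  sumBelow : ℕ → (ℕ → Carrier) → Carrier
  sumBelow zero    g = 0#
  sumBelow (suc n) g = g 0 + sumBelow n (g ∘ suc)

  foldr-map-applyUpTo : ∀ (g : ℕ → Carrier) f n → foldr _+_ 0# (map g (applyUpTo f n)) ≡ sumBelow n (g ∘ f)
  foldr-map-applyUpTo g f zero    = P.refl
  foldr-map-applyUpTo g f (suc n) = P.cong (_+_ (g (f 0))) (foldr-map-applyUpTo g (f ∘ suc) n)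

  sumBelow-≈0 : ∀ n g → (∀ j → j < n → g j ≈ 0#) → sumBelow n g ≈ 0#
  sumBelow-≈0 zero    g _    = refl
  sumBelow-≈0 (suc n) g g≈0 =
    trans (+-cong (g≈0 0 (s≤s z≤n)) (sumBelow-≈0 n (g ∘ suc) (λ j j<n → g≈0 (suc j) (s≤s j<n))))
          (+-identityʳ 0#)

  sumBelow-single : ∀ n g {j₀} → j₀ < n → (∀ j → j < n → j ≢ j₀ → g j ≈ 0#) → sumBelow n g ≈ g j₀
  sumBelow-single (suc n) g {zero} _ g≈0 =
    trans (+-cong refl (sumBelow-≈0 n (g ∘ suc) (λ j j<n → g≈0 (suc j) (s≤s j<n) λ ()))) (+-identityʳ _)
  sumBelow-single (suc n) g {suc j₀} (s≤s j₀<n) g≈0 =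
    trans (+-cong (g≈0 0 (s≤s z≤n) λ ()) (sumBelow-single n (g ∘ suc) j₀<n
            (λ j j<n j≢j₀ → g≈0 (suc j) (s≤s j<n) (j≢j₀ ∘ ℕP.suc-injective))))
          (+-identityˡ _)

  coeff-mulL : ∀ a b i → coeff (mulL F a b) i ≡ sumBelow (suc i) (λ j → coeff a j · coeff b (i ∸ j))
  coeff-mulL a b i = foldr-map-applyUpTo (λ j → coeff a j · coeff b (i ∸ j)) (λ j → j) (suc i)

  DegLe-mulL : ∀ a b {e f} → DegLe a e → DegLe b f → DegLe (mulL F a b) (e ℤ.+ f)
  DegLe-mulL a b {e} {f} a≤e b≤f m e+f<m with (top a ℤ.+ top b) ℤ.- m in eq
  ... | -[1+ _ ] = refl
  ... | + i      = P.subst (_≈ 0#) (P.sym (coeff-mulL a b i)) (sumBelow-≈0 (suc i) _ term≈0)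
    where
    term≈0 : ∀ j → j < suc i → coeff a j · coeff b (i ∸ j) ≈ 0#
    term≈0 j (s≤s j≤i) with + j ℤ.<? top a ℤ.- e
    ... | yes j<top-e = trans (*-cong (DegLe⇒coeff≈0 a j a≤e j<top-e) refl) (zeroˡ _)
    ... | no  j≮top-e = trans (*-cong refl (DegLe⇒coeff≈0 b (i ∸ j) b≤f i-j<top-f)) (zeroʳ _)
      where
      rearrange : ∀ ta tb e f m j →
        (tb ℤ.- f) ℤ.- (((ta ℤ.+ tb) ℤ.- m) ℤ.- j) ≡ (m ℤ.+ j) ℤ.- ((e ℤ.+ f) ℤ.+ (ta ℤ.- e))
      rearrange = solve-∀
      i-j≡ : + (i ∸ j) ≡ ((top a ℤ.+ top b) ℤ.- m) ℤ.- + j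
      i-j≡ = P.trans (P.sym (+m-+n≡+[m∸n] i j j≤i)) (P.cong (ℤ._- + j) (P.sym eq))
      i-j<top-f : + (i ∸ j) ℤ.< top b ℤ.- f
      i-j<top-f = P.subst (ℤ._< top b ℤ.- f) (P.sym i-j≡)
        (same-difference-< (rearrange (top a) (top b) e f m (+ j))
          (ℤP.+-mono-<-≤ e+f<m (ℤP.≮⇒≥ j≮top-e)))

  coeff-mulL-leading : ∀ a b {e f p r} → DegLe a e → DegLe b f →
    top a ℤ.- e ≡ + p → top b ℤ.- f ≡ + r → coeff (mulL F a b) (p ℕ.+ r) ≈ coeff a p · coeff b r
  coeff-mulL-leading a b {e} {f} {p} {r} a≤e b≤f top-e≡p top-f≡r =
    P.subst (_≈ coeff a p · coeff b r) (P.sym (coeff-mulL a b (p ℕ.+ r)))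
      (trans (sumBelow-single (suc (p ℕ.+ r)) _ (s≤s (ℕP.m≤m+n p r)) term≈0)
             (*-cong refl (reflexive (P.cong (coeff b) (ℕP.m+n∸m≡n p r)))))
    where
    term≈0 : ∀ j → j < suc (p ℕ.+ r) → j ≢ p → coeff a j · coeff b ((p ℕ.+ r) ∸ j) ≈ 0#
    term≈0 j (s≤s j≤p+r) j≢p with ℕP.<-cmp j p
    ... | tri≈ _ j≡p _ = ⊥-elim (j≢p j≡p)
    ... | tri< j<p _ _ = trans (*-cong (DegLe⇒coeff≈0 a j a≤e (P.subst (+ j ℤ.<_) (P.sym top-e≡p) (+<+ j<p))) refl)
                               (zeroˡ _)
    ... | tri> _ _ p<j = trans (*-cong refl (DegLe⇒coeff≈0 b _ b≤f
                                 (P.subst (+ (p ℕ.+ r ∸ j) ℤ.<_) (P.sym top-f≡r) (+<+ p+r-j<r))))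
                               (zeroʳ _)
      where
      p+r-j<r : p ℕ.+ r ∸ j < r
      p+r-j<r = ℕP.+-cancelʳ-< j _ r
        (P.subst (_< r ℕ.+ j) (P.sym (ℕP.m∸n+n≡m j≤p+r))
          (P.subst (p ℕ.+ r <_) (ℕP.+-comm j r) (ℕP.+-monoˡ-< r p<j)))

  ExactDeg-mulL : ∀ a b {e f} → ExactDeg a e → ExactDeg b f → ExactDeg (mulL F a b) (e ℤ.+ f)
  ExactDeg-mulL a b {e} {f} (a≤e , a-lead≉0) (b≤f , b-lead≉0)
    with coeffAt≉0⇒index a a-lead≉0 | coeffAt≉0⇒index b b-lead≉0
  ... | p , top-e≡p | r , top-f≡r = DegLe-mulL a b a≤e b≤f , λ ab-lead≈0 →
    x≉0∧y≉0⇒x*y≉0 a-lead≉0 b-lead≉0 (begin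
      coeffAt a e · coeffAt b f                  ≈⟨ *-cong (coeffAt-index a top-e≡p) (coeffAt-index b top-f≡r) ⟩
      coeff a p · coeff b r                      ≈⟨ coeff-mulL-leading a b a≤e b≤f top-e≡p top-f≡r ⟨
      coeff (mulL F a b) (p ℕ.+ r)               ≈⟨ coeffAt-index (mulL F a b) top-[e+f]≡p+r ⟨
      coeffAt (mulL F a b) (e ℤ.+ f)             ≈⟨ ab-lead≈0 ⟩
      0#                                         ∎)
    where
    interchange : ∀ ta tb e f → (ta ℤ.+ tb) ℤ.- (e ℤ.+ f) ≡ (ta ℤ.- e) ℤ.+ (tb ℤ.- f)
    interchange = solve-∀
    top-[e+f]≡p+r : top (mulL F a b) ℤ.- (e ℤ.+ f) ≡ + (p ℕ.+ r)
    top-[e+f]≡p+r = P.trans (interchange (top a) (top b) e f) (P.cong₂ ℤ._+_ top-e≡p top-f≡r)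

  ExactDeg-powL : ∀ ω {d} → ExactDeg ω (+ d) → ∀ k → ExactDeg (powL F ω k) (+ (k * d))
  ExactDeg-powL ω ω-deg zero    = oneL-ExactDeg
  ExactDeg-powL ω ω-deg (suc k) = ExactDeg-mulL ω (powL F ω k) ω-deg (ExactDeg-powL ω ω-deg k)

  -- Polynomials

  nthOr0-≥length : ∀ xs {j} → length xs ≤ j → nthOr0 F xs j ≡ 0#
  nthOr0-≥length []       _         = P.refl
  nthOr0-≥length (x ∷ xs) (s≤s len≤j) = nthOr0-≥length xs len≤j

  nthOr0-++-< : ∀ ys zs {j} → j < length ys → nthOr0 F (ys ++ zs) j ≡ nthOr0 F ys j
  nthOr0-++-< (y ∷ ys) zs {zero}  _         = P.refl
  nthOr0-++-< (y ∷ ys) zs {suc j} (s≤s j<n) = nthOr0-++-< ys zs j<n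

  nthOr0-∷ʳ-length : ∀ ys x → nthOr0 F (ys ++ x ∷ []) (length ys) ≡ x
  nthOr0-∷ʳ-length []       x = P.refl
  nthOr0-∷ʳ-length (y ∷ ys) x = nthOr0-∷ʳ-length ys x

  nthOr0-reverse : ∀ p i j → i ℕ.+ suc j ≡ length p → nthOr0 F (reverse p) j ≡ nthOr0 F p i
  nthOr0-reverse (x ∷ xs) zero j eq rewrite ListP.unfold-reverse x xs =
    P.subst (λ l → nthOr0 F (reverse xs ++ x ∷ []) l ≡ x)
      (P.trans (ListP.length-reverse xs) (P.sym (ℕP.suc-injective eq)))
      (nthOr0-∷ʳ-length (reverse xs) x)
  nthOr0-reverse (x ∷ xs) (suc i) j eq rewrite ListP.unfold-reverse x xs =
    P.trans (nthOr0-++-< (reverse xs) (x ∷ []) (P.subst (j <_) (P.sym (ListP.length-reverse xs)) j<len))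
            (nthOr0-reverse xs i j (ℕP.suc-injective eq))
    where
    j<len : j < length xs
    j<len = P.subst (j <_) (ℕP.suc-injective eq) (ℕP.m≤n+m (suc j) i)

  deg≡nothing⇒nthOr0≈0 : ∀ p → deg F p ≡ nothing → ∀ k → nthOr0 F p k ≈ 0#
  deg≡nothing⇒nthOr0≈0 []       _  k = refl
  deg≡nothing⇒nthOr0≈0 (a ∷ as) eq k with deg F as in as-deg
  deg≡nothing⇒nthOr0≈0 (a ∷ as) () k       | just _
  ... | nothing with a ≟ 0#
  deg≡nothing⇒nthOr0≈0 (a ∷ as) _  zero    | nothing | yes a≈0 = a≈0
  deg≡nothing⇒nthOr0≈0 (a ∷ as) _  (suc k) | nothing | yes _   = deg≡nothing⇒nthOr0≈0 as as-deg k
  deg≡nothing⇒nthOr0≈0 (a ∷ as) () k       | nothing | no  _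

  deg≡just⇒nthOr0≈0 : ∀ p {D} → deg F p ≡ just D → ∀ k → D < k → nthOr0 F p k ≈ 0#
  deg≡just⇒nthOr0≈0 (a ∷ as) eq k D<k with deg F as in as-deg
  deg≡just⇒nthOr0≈0 (a ∷ as) P.refl (suc k) (s≤s d<k) | just d = deg≡just⇒nthOr0≈0 as as-deg k d<k
  ... | nothing with a ≟ 0#
  deg≡just⇒nthOr0≈0 (a ∷ as) ()     k       _ | nothing | yes _
  deg≡just⇒nthOr0≈0 (a ∷ as) P.refl (suc k) _ | nothing | no  _ = deg≡nothing⇒nthOr0≈0 as as-deg k

  deg≤ᵈ⇒nthOr0≈0 : ∀ p {D} → deg F p ≤ᵈ D → ∀ k → D < k → nthOr0 F p k ≈ 0#
  deg≤ᵈ⇒nthOr0≈0 p p≤D k D<k with deg F p in p-deg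
  ... | nothing = deg≡nothing⇒nthOr0≈0 p p-deg k
  ... | just a  = deg≡just⇒nthOr0≈0 p p-deg k (ℕP.≤-<-trans p≤D D<k)

  deg≡just⇒nthOr0≉0 : ∀ p {D} → deg F p ≡ just D → ¬ nthOr0 F p D ≈ 0#
  deg≡just⇒nthOr0≉0 (a ∷ as) eq with deg F as in as-deg
  deg≡just⇒nthOr0≉0 (a ∷ as) P.refl | just d = deg≡just⇒nthOr0≉0 as as-deg
  ... | nothing with a ≟ 0#
  deg≡just⇒nthOr0≉0 (a ∷ as) ()     | nothing | yes _
  deg≡just⇒nthOr0≉0 (a ∷ as) P.refl | nothing | no a≉0 = a≉0

  coeffAt-polyL : ∀ p i → coeffAt (polyL F p) (+ i) ≈ nthOr0 F p i
  coeffAt-polyL []         i = IsZeroL⇒coeffAt≈0 (polyL F []) (λ _ → refl) (+ i)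
  coeffAt-polyL p@(_ ∷ xs) i with i ℕ.≤? length xs
  ... | no i≰len = trans (coeffAt-above (polyL F p) (+<+ (ℕP.≰⇒> i≰len)))
                         (sym (reflexive (nthOr0-≥length p (ℕP.≰⇒> i≰len))))
  ... | yes i≤len with ℕP.m≤n⇒∃[o]m+o≡n i≤len
  ...   | j , i+j≡len = begin
    coeffAt (polyL F p) (+ i)  ≈⟨ coeffAt-index (polyL F p) {+ i} top-i≡j ⟩
    nthOr0 F (reverse p) j     ≡⟨ nthOr0-reverse p i j (P.trans (ℕP.+-suc i j) (P.cong suc i+j≡len)) ⟩
    nthOr0 F p i               ∎
    where
    [i+j]-i≡j : ∀ i j → (i ℤ.+ j) ℤ.- i ≡ j
    [i+j]-i≡j = solve-∀
    top-i≡j : + length xs ℤ.- + i ≡ + j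
    top-i≡j = P.trans (P.cong (λ l → + l ℤ.- + i) (P.sym i+j≡len)) ([i+j]-i≡j (+ i) (+ j))

  DegLe-polyL : ∀ p {D} → deg F p ≤ᵈ D → DegLe (polyL F p) (+ D)
  DegLe-polyL p p≤D (+ i) (+<+ D<i) = trans (coeffAt-polyL p i) (deg≤ᵈ⇒nthOr0≈0 p p≤D i D<i)

  ExactDeg-polyL : ∀ p {D} → deg F p ≡ just D → ExactDeg (polyL F p) (+ D)
  ExactDeg-polyL p p-deg = DegLe-polyL p (P.subst (_≤ᵈ _) (P.sym p-deg) ℕP.≤-refl) ,
                           deg≡just⇒nthOr0≉0 p p-deg ∘ trans (sym (coeffAt-polyL p _))

  first-nonzero : ∀ (f : ℕ → Carrier) i → ¬ f i ≈ 0# →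
    ∃ λ j → j ≤ i × ¬ f j ≈ 0# × (∀ j′ → j′ < j → f j′ ≈ 0#)
  first-nonzero f zero    fᵢ≉0 = 0 , z≤n , fᵢ≉0 , λ _ ()
  first-nonzero f (suc i) fᵢ≉0 with f 0 ≟ 0#
  ... | no  f₀≉0 = 0 , z≤n , f₀≉0 , λ _ ()
  ... | yes f₀≈0 with first-nonzero (f ∘ suc) i fᵢ≉0
  ...   | j , j≤i , fⱼ≉0 , below = suc j , s≤s j≤i , fⱼ≉0 , λ where
    zero     _         → f₀≈0
    (suc j′) (s≤s j′<j) → below j′ j′<j

  first-nonzero⇒ExactDeg : ∀ a {j} → ¬ coeff a j ≈ 0# → (∀ j′ → j′ < j → coeff a j′ ≈ 0#) →
    ExactDeg a (top a ℤ.- + j)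
  first-nonzero⇒ExactDeg a {j} aⱼ≉0 below = a≤top-j , aⱼ≉0 ∘ trans (sym (coeffAt-index a (t-[t-j]≡j (top a) (+ j))))
    where
    rearrange : ∀ t j m → j ℤ.- (t ℤ.- m) ≡ m ℤ.- (t ℤ.- j)
    rearrange = solve-∀
    a≤top-j : DegLe a (top a ℤ.- + j)
    a≤top-j m top-j<m with top a ℤ.- m in eq
    ... | -[1+ _ ] = refl
    ... | + j′     = below j′ (ℤP.drop‿+<+ (P.subst (ℤ._< + j) eq
                       (same-difference-< (rearrange (top a) (+ j) m) top-j<m)))

  AbsGt1⇒ExactDeg : ∀ ω → AbsGt1 F ω → ∃ λ d → ExactDeg ω (+ suc d)
  AbsGt1⇒ExactDeg ω@(laurent (+ t) _) (i , ωᵢ≉0 , +<+ i<t)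
    with first-nonzero (coeff ω) i ωᵢ≉0
  ... | j , j≤i , ωⱼ≉0 , below with t ∸ j in t-j | ℕP.m<n⇒0<n∸m (ℕP.≤-<-trans j≤i i<t)
  ...   | suc d | _ = d , P.subst (ExactDeg ω) (P.trans (+m-+n≡+[m∸n] t j j≤t) (P.cong +_ t-j))
                             (first-nonzero⇒ExactDeg ω ωⱼ≉0 below)
    where j≤t = ℕP.<⇒≤ (ℕP.≤-<-trans j≤i i<t)

  -- Evaluating Λ

  module Summands (λs : ℕ → Poly F) (ω : Laurent F) where

    summand : ℕ → Laurent F
    summand i = mulL F (polyL F (λs i)) (powL F ω i)

    DegLe-summand : ∀ {d} → ExactDeg ω (+ d) → ∀ i {b} → deg F (λs i) ≤ᵈ b →
      DegLe (summand i) (+ (b ℕ.+ i * d))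
    DegLe-summand ω-deg i λᵢ≤b =
      DegLe-mulL (polyL F (λs i)) (powL F ω i) (DegLe-polyL (λs i) λᵢ≤b) (proj₁ (ExactDeg-powL ω ω-deg i))

    coeffAt-lowerSum-≈0 : ∀ K m → (∀ i → i < K → coeffAt (summand i) m ≈ 0#) → coeffAt (lowerSum F λs ω K) m ≈ 0#
    coeffAt-lowerSum-≈0 zero    m _   = IsZeroL⇒coeffAt≈0 (zeroL F) (λ _ → refl) m
    coeffAt-lowerSum-≈0 (suc K) m ≈0 =
      trans (coeffAt-addL (lowerSum F λs ω K) (summand K) m)
            (trans (+-cong (coeffAt-lowerSum-≈0 K m (λ i i<K → ≈0 i (ℕP.m≤n⇒m≤1+n i<K))) (≈0 K ℕP.≤-refl))
                   (+-identityʳ 0#))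

    coeffAt-lowerSum-single : ∀ K m {i₀} → i₀ < K → (∀ i → i < K → i ≢ i₀ → coeffAt (summand i) m ≈ 0#) →
      coeffAt (lowerSum F λs ω K) m ≈ coeffAt (summand i₀) m
    coeffAt-lowerSum-single (suc K) m (s≤s i₀≤K) ≈0 with ℕP.m≤n⇒m<n∨m≡n i₀≤K
    ... | inj₁ i₀<K = trans (coeffAt-addL (lowerSum F λs ω K) (summand K) m)
      (trans (+-cong (coeffAt-lowerSum-single K m i₀<K (λ i i<K → ≈0 i (ℕP.m≤n⇒m≤1+n i<K)))
                     (≈0 K ℕP.≤-refl (ℕP.<⇒≢ i₀<K ∘ P.sym)))
             (+-identityʳ _))
    ... | inj₂ P.refl = trans (coeffAt-addL (lowerSum F λs ω K) (summand K) m)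
      (trans (+-cong (coeffAt-lowerSum-≈0 K m (λ i i<K → ≈0 i (ℕP.m≤n⇒m≤1+n i<K) (ℕP.<⇒≢ i<K))) refl)
             (+-identityˡ _))

    root⇒coeffAt-cancels : ∀ n → IsZeroL F (evalΛ F n λs ω) →
      ∀ m → coeffAt (powL F ω n) m + coeffAt (lowerSum F λs ω n) m ≈ 0#
    root⇒coeffAt-cancels n root m =
      trans (sym (coeffAt-addL (powL F ω n) (lowerSum F λs ω n) m)) (IsZeroL⇒coeffAt≈0 (evalΛ F n λs ω) root m)

    powL-dominates : ∀ n m → ¬ coeffAt (powL F ω n) m ≈ 0# →
      (∀ i → i < n → coeffAt (summand i) m ≈ 0#) → ¬ IsZeroL F (evalΛ F n λs ω)
    powL-dominates n m ωⁿ≉0 ≈0 root = ωⁿ≉0 (begin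
      coeffAt (powL F ω n) m                                         ≈⟨ +-identityʳ _ ⟨
      coeffAt (powL F ω n) m + 0#                                    ≈⟨ +-cong refl (coeffAt-lowerSum-≈0 n m ≈0) ⟨
      coeffAt (powL F ω n) m + coeffAt (lowerSum F λs ω n) m         ≈⟨ root⇒coeffAt-cancels n root m ⟩
      0#                                                             ∎)

    summand-dominates : ∀ n m {i₀} → i₀ < n → ¬ coeffAt (summand i₀) m ≈ 0# → coeffAt (powL F ω n) m ≈ 0# →
      (∀ i → i < n → i ≢ i₀ → coeffAt (summand i) m ≈ 0#) → ¬ IsZeroL F (evalΛ F n λs ω)
    summand-dominates n m {i₀} i₀<n i₀≉0 ωⁿ≈0 ≈0 root = i₀≉0 (begin
      coeffAt (summand i₀) m                                         ≈⟨ coeffAt-lowerSum-single n m i₀<n ≈0 ⟨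
      coeffAt (lowerSum F λs ω n) m                                  ≈⟨ +-identityˡ _ ⟨
      0# + coeffAt (lowerSum F λs ω n) m                             ≈⟨ +-cong ωⁿ≈0 refl ⟨
      coeffAt (powL F ω n) m + coeffAt (lowerSum F λs ω n) m         ≈⟨ root⇒coeffAt-cancels n root m ⟩
      0#                                                             ∎)

  module _ {λs : ℕ → Poly F} {ω : Laurent F} {s d k : ℕ}
    (ω-deg : ExactDeg ω (+ d))
    (λ≤D : ∀ i → i ≤ s → deg F (λs i) ≤ᵈ suc (2 * k))
    (λ₁₊ₛ≤k : deg F (λs (suc s)) ≤ᵈ k)
    where
    open Summands λs ω

    noRoot-if-k<d : k < d → ¬ IsZeroL F (evalΛ F (suc (suc s)) λs ω)
    noRoot-if-k<d k<d =
      powL-dominates (suc (suc s)) (+ M) (proj₂ (ExactDeg-powL ω ω-deg (suc (suc s)))) summand≈0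
      where
      M = suc (suc s) * d
      summand≈0 : ∀ i → i < suc (suc s) → coeffAt (summand i) (+ M) ≈ 0#
      summand≈0 i (s≤s i≤1+s) with ℕP.m≤n⇒m<n∨m≡n i≤1+s
      ... | inj₁ (s≤s i≤s) = DegLe-summand ω-deg i (λ≤D i i≤s) (+ M) (+<+
              (P.subst (suc (2 * k) ℕ.+ i * d <_) (ℕP.+-assoc d d (s * d))
                (ℕP.+-mono-<-≤ (m<n⇒1+2m<n+n k<d) (ℕP.*-monoˡ-≤ d i≤s))))
      ... | inj₂ P.refl = DegLe-summand ω-deg (suc s) λ₁₊ₛ≤k (+ M) (+<+ (ℕP.+-monoˡ-< (suc s * d) k<d))

    noRoot-if-d≤k : .{{_ : ℕ.NonZero d}} → d ≤ k → deg F (λs s) ≡ just (suc (2 * k)) →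
      ¬ IsZeroL F (evalΛ F (suc (suc s)) λs ω)
    noRoot-if-d≤k d≤k λₛ-deg =
      summand-dominates (suc (suc s)) (+ M) (ℕP.m≤n⇒m≤1+n ℕP.≤-refl) summandₛ≉0 ωⁿ≈0 summand≈0
      where
      M = suc (2 * k) ℕ.+ s * d
      summandₛ≉0 : ¬ coeffAt (summand s) (+ M) ≈ 0#
      summandₛ≉0 = proj₂ (ExactDeg-mulL (polyL F (λs s)) (powL F ω s)
                     (ExactDeg-polyL (λs s) λₛ-deg) (ExactDeg-powL ω ω-deg s))
      ωⁿ≈0 : coeffAt (powL F ω (suc (suc s))) (+ M) ≈ 0#
      ωⁿ≈0 = proj₁ (ExactDeg-powL ω ω-deg (suc (suc s))) (+ M) (+<+
               (P.subst (_< M) (ℕP.+-assoc d d (s * d)) (ℕP.+-monoˡ-< (s * d) (m≤k⇒n≤k⇒m+n<1+2k d≤k d≤k))))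
      summand≈0 : ∀ i → i < suc (suc s) → i ≢ s → coeffAt (summand i) (+ M) ≈ 0#
      summand≈0 i (s≤s i≤1+s) i≢s with ℕP.m≤n⇒m<n∨m≡n i≤1+s
      ... | inj₁ (s≤s i≤s) = DegLe-summand ω-deg i (λ≤D i i≤s) (+ M) (+<+
              (ℕP.+-monoʳ-< (suc (2 * k)) (ℕP.*-monoˡ-< d (ℕP.≤∧≢⇒< i≤s i≢s))))
      ... | inj₂ P.refl = DegLe-summand ω-deg (suc s) λ₁₊ₛ≤k (+ M) (+<+
              (P.subst (_< M) (ℕP.+-assoc k d (s * d)) (ℕP.+-monoˡ-< (s * d) (m≤k⇒n≤k⇒m+n<1+2k ℕP.≤-refl d≤k))))

    noRoot : .{{_ : ℕ.NonZero d}} → deg F (λs s) ≡ just (suc (2 * k)) →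
      ¬ IsZeroL F (evalΛ F (suc (suc s)) λs ω)
    noRoot λₛ-deg with d ℕ.≤? k
    ... | yes d≤k = noRoot-if-d≤k d≤k λₛ-deg
    ... | no  d≰k = noRoot-if-k<d (ℕP.≰⇒> d≰k)

lemma5p1 : {c ℓ : Level} (F : FiniteField c ℓ) (n : ℕ) → 3 ≤ n →
  (λs : ℕ → Poly F) →
  deg F (λs 0) ≢ nothing →
  (D : ℕ) → deg F (λs (n ∸ 2)) ≡ just D →
  (∀ i → i < n → i ≢ n ∸ 2 → deg F (λs i) ≤ᵈ D) →
  (∃ λ i → i < n × i ≢ n ∸ 2 × deg F (λs i) ≡ just D) →
  twice (deg F (λs (n ∸ 1))) ≤ᵈ D →
  (∃ λ k → D ≡ suc (2 * k)) →
  ¬ (∃ λ ω → AbsGt1 F ω × IsZeroL F (evalΛ F n λs ω))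
lemma5p1 F (suc (suc (suc s′))) (s≤s (s≤s (s≤s _))) λs _ _ λₛ-deg λᵢ≤D _ twice≤D (k , P.refl) (ω , |ω|>1 , root)
  with AbsGt1⇒ExactDeg F ω |ω|>1
... | _ , ω-deg = noRoot F {k = k} ω-deg λ≤D (twice≤ᵈ1+2k⇒≤ᵈk twice≤D) λₛ-deg root
  where
  λ≤D : ∀ i → i ≤ suc s′ → deg F (λs i) ≤ᵈ suc (2 * k)
  λ≤D i i≤s with i ℕ.≟ suc s′
  ... | yes P.refl = P.subst (_≤ᵈ _) (P.sym λₛ-deg) ℕP.≤-refl
  ... | no  i≢s    = λᵢ≤D i (ℕP.m≤n⇒m≤1+n (s≤s i≤s)) i≢s
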